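{- Let $n\ge 1$ and let $z=a+ib$ be a Gaussian integer with integers $a\ge 0$, $b\ge 0$, $a+b$ even and $a+b>0$. Let $A=A(z,n)$ be the $n\times n$ matrix with entries $A_{kl}=1$ if $z+k+il$ is a Gaussian prime and $A_{kl}=0$ otherwise ($1\le k,l\le n$), and let $P$ be the $n\times n$ diagonal matrix with $P_{jj}=(-1)^j$. Then $PA+AP=0$, and consequently the spectrum of $A$ satisfies $\sigma(A)=-\sigma(A)$.
   Context: A Gaussian prime is an irreducible element of the ring $\mathbb{Z}[i]$ of Gaussian integers. $\sigma(A)$ denotes the set of eigenvalues of $A$ in $\mathbb{C}$. -}

module Defs where

open import Level using (Level; _⊔_)
open import Data.Nat as ℕ using (ℕ; zero; suc)
open import Data.Integer as ℤ using (ℤ; +_; -[1+_])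
open import Data.Fin using (Fin; toℕ)
import Data.Fin as Fin
open import Data.Product using (Σ; ∃; _×_; _,_)
open import Relation.Binary.PropositionalEquality using (_≡_)
open import Relation.Nullary using (¬_)
open import Algebra.Bundles using (CommutativeRing)

record ℤ[i] : Set where
  constructor _+i_
  field
    re : ℤ
    im : ℤ
open ℤ[i] public

0ᴳ 1ᴳ : ℤ[i]
0ᴳ = (+ 0) +i (+ 0)
1ᴳ = (+ 1) +i (+ 0)

_+ᴳ_ : ℤ[i] → ℤ[i] → ℤ[i]
(a +i b) +ᴳ (c +i d) = (a ℤ.+ c) +i (b ℤ.+ d)

_*ᴳ_ : ℤ[i] → ℤ[i] → ℤ[i]
(a +i b) *ᴳ (c +i d) = ((a ℤ.* c) ℤ.- (b ℤ.* d)) +i ((a ℤ.* d) ℤ.+ (b ℤ.* c))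

IsUnitᴳ : ℤ[i] → Set
IsUnitᴳ u = ∃ λ v → u *ᴳ v ≡ 1ᴳ

-- Gaussian prime = irreducible element of ℤ[i]:
-- nonzero, not a unit, and any factorisation has a unit factor
GaussianPrime : ℤ[i] → Set
GaussianPrime w =
  ¬ (w ≡ 0ᴳ) × ¬ IsUnitᴳ w ×
  (∀ x y → w ≡ x *ᴳ y → IsUnitᴳ x ⊎' IsUnitᴳ y)
  where
  open import Data.Sum using () renaming (_⊎_ to _⊎'_)

-- Integer matrices (indices Fin n represent 1,…,n via k ↦ toℕ k + 1)

Matrix : Set → ℕ → Set
Matrix A n = Fin n → Fin n → A

sumℤ : ∀ {n} → (Fin n → ℤ) → ℤ
sumℤ {zero}  f = + 0
sumℤ {suc n} f = f Fin.zero ℤ.+ sumℤ (λ i → f (Fin.suc i))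

_*ᴹ_ : ∀ {n} → Matrix ℤ n → Matrix ℤ n → Matrix ℤ n
(M *ᴹ N) k l = sumℤ (λ j → M k j ℤ.* N j l)

_+ᴹ_ : ∀ {n} → Matrix ℤ n → Matrix ℤ n → Matrix ℤ n
(M +ᴹ N) k l = M k l ℤ.+ N k l

sign : ℕ → ℤ
sign zero    = + 1
sign (suc j) = ℤ.- sign j

Pmat : ∀ n → Matrix ℤ n
Pmat n k l with k Fin.≟ l
... | Relation.Nullary.yes _ = sign (suc (toℕ k))
... | Relation.Nullary.no  _ = + 0
  where import Relation.Nullary

-- A(z,n): A_kl = 1 if z + k + i l is a Gaussian prime, 0 otherwise
-- (stated as a specification, since the entries are given by a property)
IsPrimeMatrix : ∀ n → ℤ[i] → Matrix ℤ n → Set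
IsPrimeMatrix n z A =
  ∀ (k l : Fin n) →
    let w = z +ᴳ ((+ suc (toℕ k)) +i (+ suc (toℕ l))) in
    (GaussianPrime w → A k l ≡ + 1) × (¬ GaussianPrime w → A k l ≡ + 0)

module _ {c ℓ : Level} (R : CommutativeRing c ℓ) where
  open CommutativeRing R

  ℕ→R : ℕ → Carrier
  ℕ→R zero    = 0#
  ℕ→R (suc n) = 1# + ℕ→R n

  ℤ→R : ℤ → Carrier
  ℤ→R (+ n)      = ℕ→R n
  ℤ→R -[1+ n ]   = - (ℕ→R (suc n))

  sumR : ∀ {n} → (Fin n → Carrier) → Carrier
  sumR {zero}  f = 0#
  sumR {suc n} f = f Fin.zero + sumR (λ i → f (Fin.suc i))

  IsEigenvalue : ∀ {n} → Matrix ℤ n → Carrier → Set (c ⊔ ℓ)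
  IsEigenvalue {n} M μ =
    Σ (Fin n → Carrier) λ v →
      ¬ (∀ i → v i ≈ 0#) ×
      (∀ i → sumR (λ j → ℤ→R (M i j) * v j) ≈ μ * v i)

module Submission where

-- Index the rows and columns by 1,…,n.  If k + l is even
-- then z + k + il = (a + k) + i(b + l) has even "trace" x + y = 2M with M ≥ 2,
-- hence factors as (1 + i)(M + i(y − M)) into two non-units (norms 2 and ≥ M²),
-- so it is not a Gaussian prime and A_kl = 0: A is a *checkerboard* matrix.
-- For such a matrix the signs s_j = (-1)^j satisfy A_kl s_l = − s_k A_kl for all
-- k, l (either A_kl = 0, or k + l is odd and s_l = − s_k).  Read over ℤ this is
-- (PA + AP)_kl = 0; read over an arbitrary commutative ring R it says that
-- v ↦ Pv sends μ-eigenvectors of A to (−μ)-eigenvectors, and P is invertible.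

open import Defs
open import Data.Nat using (ℕ; _≥_; _>_; _+_)
open import Data.Integer using (ℤ; +_)
open import Data.Fin using (Fin)
open import Data.Product using (_×_)
open import Relation.Binary.PropositionalEquality using (_≡_)
open import Algebra.Bundles using (CommutativeRing)
open import Data.Nat.Divisibility using (_∣_)

open import Level using (Level)
open import Data.Nat using (zero; suc)
import Data.Nat as ℕ
open import Data.Nat.Properties using (+-suc; m*n≡1⇒m≡1)
open import Data.Nat.Divisibility using (divides)
open import Data.Nat.Tactic.RingSolver using () renaming (solve-∀ to ℕ-solve-∀)
import Data.Integer as ℤ
open import Data.Integer using (-[1+_])
open import Data.Integer.Properties
  using (pos-*; abs-*; +-identityˡ; +-identityʳ; *-zeroʳ; +-inverseʳ; +-*-commutativeRing)
open import Data.Integer.Tactic.RingSolver using (solve-∀)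
open import Data.Fin using (toℕ)
import Data.Fin as Fin
open import Data.Fin.Properties using (suc-injective)
open import Data.Product using (Σ; _,_; proj₂)
open import Data.Sum using (_⊎_; inj₁; inj₂; [_,_]′)
open import Data.Empty using (⊥-elim)
open import Relation.Nullary using (¬_; yes; no)
open import Relation.Binary.PropositionalEquality
  using (refl; sym; trans; cong; cong₂; _≢_; module ≡-Reasoning)

N : ℤ[i] → ℤ
N (x +i y) = x ℤ.* x ℤ.+ y ℤ.* y

N-* : ∀ u w → N (u *ᴳ w) ≡ N u ℤ.* N w
N-* (a +i b) (c +i d) = identity a b c d
  where
  identity : ∀ a b c d →
    ((a ℤ.* c) ℤ.- (b ℤ.* d)) ℤ.* ((a ℤ.* c) ℤ.- (b ℤ.* d)) ℤ.+
    ((a ℤ.* d) ℤ.+ (b ℤ.* c)) ℤ.* ((a ℤ.* d) ℤ.+ (b ℤ.* c))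
    ≡ (a ℤ.* a ℤ.+ b ℤ.* b) ℤ.* (c ℤ.* c ℤ.+ d ℤ.* d)
  identity = solve-∀

-- A unit u (u w = 1) has norm ±1, since N u · N w = N 1 = 1.
unit⇒∣N∣≡1 : ∀ u → IsUnitᴳ u → ℤ.∣ N u ∣ ≡ 1
unit⇒∣N∣≡1 u (w , uw≡1) = m*n≡1⇒m≡1 ℤ.∣ N u ∣ ℤ.∣ N w ∣
  (trans (sym (abs-* (N u) (N w))) (cong ℤ.∣_∣ (trans (sym (N-* u w)) (cong N uw≡1))))

square≡∣∣² : ∀ i → i ℤ.* i ≡ + (ℤ.∣ i ∣ ℕ.* ℤ.∣ i ∣)
square≡∣∣² (+ n)    = sym (pos-* n n)
square≡∣∣² -[1+ n ] = refl

1+i : ℤ[i]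
1+i = (+ 1) +i (+ 1)

-- 1 + i is not a unit: its norm is 2.
1+i-nonUnit : ¬ IsUnitᴳ 1+i
1+i-nonUnit u with unit⇒∣N∣≡1 1+i u
... | ()

∣N∣≡sumOfSquares : ∀ x y → ℤ.∣ N (x +i y) ∣ ≡ ℤ.∣ x ∣ ℕ.* ℤ.∣ x ∣ + ℤ.∣ y ∣ ℕ.* ℤ.∣ y ∣
∣N∣≡sumOfSquares x y = cong ℤ.∣_∣ (cong₂ ℤ._+_ (square≡∣∣² x) (square≡∣∣² y))

-- An element whose real part is at least 2 is not a unit: its norm is ≥ 4.
large-nonUnit : ∀ m v → ¬ IsUnitᴳ ((+ suc (suc m)) +i v)
large-nonUnit m v u
  with trans (sym (∣N∣≡sumOfSquares (+ suc (suc m)) v)) (unit⇒∣N∣≡1 ((+ suc (suc m)) +i v) u)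
... | ()

evenTrace-factorisation : ∀ x y M → x + y ≡ M + M →
                          (+ x) +i (+ y) ≡ 1+i *ᴳ ((+ M) +i (+ y ℤ.- + M))
evenTrace-factorisation x y M x+y≡2M =
  cong₂ _+i_ (sym realPart) (sym (imaginaryPart (+ M) (+ y)))
  where
  open ≡-Reasoning
  expand : ∀ M y → (+ 1) ℤ.* M ℤ.- (+ 1) ℤ.* (y ℤ.- M) ≡ (M ℤ.+ M) ℤ.- y
  expand = solve-∀
  cancel : ∀ x y → (x ℤ.+ y) ℤ.- y ≡ x
  cancel = solve-∀
  realPart : (+ 1) ℤ.* (+ M) ℤ.- (+ 1) ℤ.* (+ y ℤ.- + M) ≡ + x
  realPart = begin
    (+ 1) ℤ.* (+ M) ℤ.- (+ 1) ℤ.* (+ y ℤ.- + M)  ≡⟨ expand (+ M) (+ y) ⟩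
    (+ M ℤ.+ + M) ℤ.- + y                        ≡⟨ cong (ℤ._- + y) (sym (cong +_ x+y≡2M)) ⟩
    (+ x ℤ.+ + y) ℤ.- + y                        ≡⟨ cancel (+ x) (+ y) ⟩
    + x                                          ∎
  imaginaryPart : ∀ M y → (+ 1) ℤ.* (y ℤ.- M) ℤ.+ (+ 1) ℤ.* M ≡ y
  imaginaryPart = solve-∀

-- If x, y ≥ 0 and x + y = 2M with M ≥ 2, the factorisation above has two
-- non-unit factors, so x + iy is not a Gaussian prime.
evenTrace⇒¬prime : ∀ x y m → x + y ≡ suc (suc m) + suc (suc m) →
                   ¬ GaussianPrime ((+ x) +i (+ y))
evenTrace⇒¬prime x y m x+y≡2M (_ , _ , irreducible) =
  [ 1+i-nonUnit , large-nonUnit m cofactorIm ]′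
    (irreducible 1+i ((+ suc (suc m)) +i cofactorIm)
                 (evenTrace-factorisation x y (suc (suc m)) x+y≡2M))
  where
  cofactorIm : ℤ
  cofactorIm = + y ℤ.- + suc (suc m)

parity : ∀ n → Σ ℕ λ t → n ≡ t + t ⊎ n ≡ suc (t + t)
parity zero = 0 , inj₁ refl
parity (suc n) with parity n
... | t , inj₁ n≡2t  = t , inj₂ (cong suc n≡2t)
... | t , inj₂ n≡2t+1 = suc t , inj₁ (cong suc (trans n≡2t+1 (sym (+-suc t t))))

module Signs {c ℓ : Level} (R : CommutativeRing c ℓ) where
  open CommutativeRing R hiding (_+_) renaming (refl to ≈-refl; sym to ≈-sym; trans to ≈-trans)
  open import Algebra.Properties.Ring ring using (-‿distribˡ-*; -‿distribʳ-*; -‿involutive; -0#≈0#)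
  open import Relation.Binary.Reasoning.Setoid setoid

  signᴿ : ℕ → Carrier
  signᴿ zero    = 1#
  signᴿ (suc j) = - signᴿ j

  signᴿ-even : ∀ t → signᴿ (t + t) ≈ 1#
  signᴿ-even zero = ≈-refl
  signᴿ-even (suc t) rewrite +-suc t t = ≈-trans (-‿involutive _) (signᴿ-even t)

  signᴿ-square : ∀ j → signᴿ j * signᴿ j ≈ 1#
  signᴿ-square zero    = *-identityˡ 1#
  signᴿ-square (suc j) = begin
    - signᴿ j * - signᴿ j    ≈⟨ -‿distribˡ-* _ _ ⟨
    - (signᴿ j * - signᴿ j)  ≈⟨ -‿cong (-‿distribʳ-* _ _) ⟨
    - - (signᴿ j * signᴿ j)  ≈⟨ -‿involutive _ ⟩
    signᴿ j * signᴿ j        ≈⟨ signᴿ-square j ⟩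
    1#                       ∎

  signᴿ-checkerboard : ∀ k l → 2 ∣ k + l ⊎ signᴿ l ≈ - signᴿ k
  signᴿ-checkerboard k l with parity k | parity l
  ... | s , inj₁ refl | t , inj₁ refl = inj₁ (divides (s + t) (evens s t))
    where
    evens : ∀ s t → (s + s) + (t + t) ≡ (s + t) ℕ.* 2
    evens = ℕ-solve-∀
  ... | s , inj₂ refl | t , inj₂ refl = inj₁ (divides (suc (s + t)) (odds s t))
    where
    odds : ∀ s t → suc (s + s) + suc (t + t) ≡ suc (s + t) ℕ.* 2
    odds = ℕ-solve-∀
  ... | s , inj₁ refl | t , inj₂ refl = inj₂ (-‿cong (≈-trans (signᴿ-even t) (≈-sym (signᴿ-even s))))
  ... | s , inj₂ refl | t , inj₁ refl =
    inj₂ (≈-trans (≈-trans (signᴿ-even t) (≈-sym (signᴿ-even s))) (≈-sym (-‿involutive _)))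

  anticommute-entry : ∀ k l x → (2 ∣ k + l → x ≈ 0#) → x * signᴿ l ≈ - (signᴿ k * x)
  anticommute-entry k l x vanish with signᴿ-checkerboard k l
  ... | inj₁ even = begin
    x * signᴿ l         ≈⟨ *-congʳ (vanish even) ⟩
    0# * signᴿ l        ≈⟨ zeroˡ _ ⟩
    0#                  ≈⟨ -0#≈0# ⟨
    - 0#                ≈⟨ -‿cong (zeroʳ _) ⟨
    - (signᴿ k * 0#)    ≈⟨ -‿cong (*-congˡ (vanish even)) ⟨
    - (signᴿ k * x)     ∎
  ... | inj₂ opposite = begin
    x * signᴿ l         ≈⟨ *-congˡ opposite ⟩
    x * - signᴿ k       ≈⟨ -‿distribʳ-* _ _ ⟨
    - (x * signᴿ k)     ≈⟨ -‿cong (*-comm _ _) ⟩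
    - (signᴿ k * x)     ∎

IsCheckerboard : ∀ {n} → Matrix ℤ n → Set
IsCheckerboard A = ∀ k l → 2 ∣ suc (toℕ k) + suc (toℕ l) → A k l ≡ + 0

-- For a + b even and positive, every position with k + l even carries an
-- element of even trace 2M with M ≥ 2, so the prime matrix is checkerboard.
primeMatrix⇒checkerboard : ∀ n a b → 2 ∣ (a + b) → a + b > 0 →
  (A : Matrix ℤ n) → IsPrimeMatrix n ((+ a) +i (+ b)) A → IsCheckerboard A
primeMatrix⇒checkerboard n a b (divides zero a+b≡0) a+b>0 _ _ _ _ _
  rewrite a+b≡0 with a+b>0
... | ()
primeMatrix⇒checkerboard n a b (divides (suc q) a+b≡2q) _ A isPrime k l (divides (suc r) k+l≡2r) =
  proj₂ (isPrime k l) (evenTrace⇒¬prime (a + suc (toℕ k)) (b + suc (toℕ l)) (q + r) trace)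
  where
  open ≡-Reasoning
  trace : (a + suc (toℕ k)) + (b + suc (toℕ l)) ≡ suc (suc (q + r)) + suc (suc (q + r))
  trace = begin
    (a + suc (toℕ k)) + (b + suc (toℕ l))  ≡⟨ regroup a b (suc (toℕ k)) (suc (toℕ l)) ⟩
    (a + b) + (suc (toℕ k) + suc (toℕ l))  ≡⟨ cong₂ _+_ a+b≡2q k+l≡2r ⟩
    suc q ℕ.* 2 + suc r ℕ.* 2              ≡⟨ halve q r ⟩
    suc (suc (q + r)) + suc (suc (q + r))  ∎
    where
    regroup : ∀ a b k l → (a + k) + (b + l) ≡ (a + b) + (k + l)
    regroup = ℕ-solve-∀
    halve : ∀ q r → suc q ℕ.* 2 + suc r ℕ.* 2 ≡ suc (suc (q + r)) + suc (suc (q + r))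
    halve = ℕ-solve-∀

sumℤ-zero : ∀ {n} (f : Fin n → ℤ) → (∀ j → f j ≡ + 0) → sumℤ f ≡ + 0
sumℤ-zero {zero}  f _ = refl
sumℤ-zero {suc n} f f≡0 rewrite f≡0 Fin.zero =
  trans (+-identityˡ _) (sumℤ-zero (λ j → f (Fin.suc j)) (λ j → f≡0 (Fin.suc j)))

sumℤ-single : ∀ {n} (f : Fin n → ℤ) (k : Fin n) → (∀ j → j ≢ k → f j ≡ + 0) →
              sumℤ f ≡ f k
sumℤ-single {suc n} f Fin.zero off =
  trans (cong (λ rest → f Fin.zero ℤ.+ rest) (sumℤ-zero _ (λ j → off (Fin.suc j) (λ ()))))
        (+-identityʳ _)
sumℤ-single {suc n} f (Fin.suc k) off rewrite off Fin.zero (λ ()) =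
  trans (+-identityˡ _)
        (sumℤ-single (λ j → f (Fin.suc j)) k (λ j j≢k → off (Fin.suc j) (λ e → j≢k (suc-injective e))))

Pmat-diag : ∀ n k → Pmat n k k ≡ sign (suc (toℕ k))
Pmat-diag n k with k Fin.≟ k
... | yes _   = refl
... | no k≢k = ⊥-elim (k≢k refl)

Pmat-offdiag : ∀ n k j → j ≢ k → Pmat n k j ≡ + 0
Pmat-offdiag n k j j≢k with k Fin.≟ j
... | yes k≡j = ⊥-elim (j≢k (sym k≡j))
... | no _    = refl

P*ᴹ : ∀ {n} (A : Matrix ℤ n) k l → (Pmat n *ᴹ A) k l ≡ sign (suc (toℕ k)) ℤ.* A k l
P*ᴹ {n} A k l =
  trans (sumℤ-single _ k (λ j j≢k → cong (ℤ._* A j l) (Pmat-offdiag n k j j≢k)))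
        (cong (ℤ._* A k l) (Pmat-diag n k))

*ᴹP : ∀ {n} (A : Matrix ℤ n) k l → (A *ᴹ Pmat n) k l ≡ A k l ℤ.* sign (suc (toℕ l))
*ᴹP {n} A k l =
  trans (sumℤ-single _ l (λ j j≢l →
           trans (cong (A k j ℤ.*_) (Pmat-offdiag n j l (λ l≡j → j≢l (sym l≡j)))) (*-zeroʳ (A k j))))
        (cong (A k l ℤ.*_) (Pmat-diag n l))

module ℤSigns = Signs +-*-commutativeRing

sign≡signᴿ : ∀ j → sign j ≡ ℤSigns.signᴿ j
sign≡signᴿ zero    = refl
sign≡signᴿ (suc j) = cong ℤ.-_ (sign≡signᴿ j)

checkerboard-anticommutes : ∀ {n} (A : Matrix ℤ n) → IsCheckerboard A →
  ∀ k l → ((Pmat n *ᴹ A) +ᴹ (A *ᴹ Pmat n)) k l ≡ + 0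
checkerboard-anticommutes A checker k l
  rewrite P*ᴹ A k l | *ᴹP A k l
        | sign≡signᴿ (suc (toℕ k)) | sign≡signᴿ (suc (toℕ l))
        | ℤSigns.anticommute-entry (suc (toℕ k)) (suc (toℕ l)) (A k l) (checker k l)
  = +-inverseʳ (ℤSigns.signᴿ (suc (toℕ k)) ℤ.* A k l)

-- Over any commutative ring R: if P anticommutes with A, then v ↦ Pv maps
-- μ-eigenvectors to (−μ)-eigenvectors, so σ(A) = −σ(A).
module Spectrum {c ℓ : Level} (R : CommutativeRing c ℓ) where
  open CommutativeRing R renaming (refl to ≈-refl; sym to ≈-sym; trans to ≈-trans)
  open Signs R
  open import Algebra.Properties.Ring ring using (-‿distribˡ-*; -‿involutive)
  open import Relation.Binary.Reasoning.Setoid setoid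

  sumR-cong : ∀ {n} {f g : Fin n → Carrier} → (∀ j → f j ≈ g j) → sumR R f ≈ sumR R g
  sumR-cong {zero}  _   = ≈-refl
  sumR-cong {suc n} f≈g = +-cong (f≈g Fin.zero) (sumR-cong (λ j → f≈g (Fin.suc j)))

  sumR-*ˡ : ∀ {n} x (f : Fin n → Carrier) → sumR R (λ j → x * f j) ≈ x * sumR R f
  sumR-*ˡ {zero}  x f = ≈-sym (zeroʳ x)
  sumR-*ˡ {suc n} x f =
    ≈-trans (+-congˡ (sumR-*ˡ x (λ j → f (Fin.suc j)))) (≈-sym (distribˡ x _ _))

  module _ {n : ℕ} (A : Matrix ℤ n)
           (anticommutes : ∀ i j → ℤ→R R (A i j) * signᴿ (suc (toℕ j))
                                   ≈ - (signᴿ (suc (toℕ i)) * ℤ→R R (A i j))) where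

    private
      s : Fin n → Carrier
      s j = signᴿ (suc (toℕ j))

      a : Fin n → Fin n → Carrier
      a i j = ℤ→R R (A i j)

    eigenvalue-neg : ∀ μ → IsEigenvalue R A μ → IsEigenvalue R A (- μ)
    eigenvalue-neg μ (v , v≢0 , Av≈μv) = Pv , Pv≢0 , APv≈-μPv
      where
      Pv : Fin n → Carrier
      Pv j = s j * v j

      -- P² = 1, so Pv = 0 would force v = 0.
      Pv≢0 : ¬ (∀ i → Pv i ≈ 0#)
      Pv≢0 Pv≈0 = v≢0 λ i → begin
        v i                ≈⟨ *-identityˡ _ ⟨
        1# * v i           ≈⟨ *-congʳ (signᴿ-square (suc (toℕ i))) ⟨
        (s i * s i) * v i  ≈⟨ *-assoc _ _ _ ⟩
        s i * Pv i         ≈⟨ *-congˡ (Pv≈0 i) ⟩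
        s i * 0#           ≈⟨ zeroʳ _ ⟩
        0#                 ∎

      term : ∀ i j → a i j * Pv j ≈ - s i * (a i j * v j)
      term i j = begin
        a i j * (s j * v j)        ≈⟨ *-assoc _ _ _ ⟨
        (a i j * s j) * v j        ≈⟨ *-congʳ (anticommutes i j) ⟩
        (- (s i * a i j)) * v j    ≈⟨ *-congʳ (-‿distribˡ-* _ _) ⟩
        (- s i * a i j) * v j      ≈⟨ *-assoc _ _ _ ⟩
        - s i * (a i j * v j)      ∎

      APv≈-μPv : ∀ i → sumR R (λ j → a i j * Pv j) ≈ (- μ) * Pv i
      APv≈-μPv i = begin
        sumR R (λ j → a i j * Pv j)          ≈⟨ sumR-cong {n} (term i) ⟩
        sumR R (λ j → - s i * (a i j * v j)) ≈⟨ sumR-*ˡ {n} _ _ ⟩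
        - s i * sumR R (λ j → a i j * v j)   ≈⟨ *-congˡ (Av≈μv i) ⟩
        - s i * (μ * v i)                    ≈⟨ -‿distribˡ-* _ _ ⟨
        - (s i * (μ * v i))                  ≈⟨ -‿cong (*-assoc _ _ _) ⟨
        - ((s i * μ) * v i)                  ≈⟨ -‿cong (*-congʳ (*-comm _ _)) ⟩
        - ((μ * s i) * v i)                  ≈⟨ -‿cong (*-assoc _ _ _) ⟩
        - (μ * Pv i)                         ≈⟨ -‿distribˡ-* _ _ ⟩
        (- μ) * Pv i                         ∎

    eigenvalue-cong : ∀ {μ ν} → μ ≈ ν → IsEigenvalue R A μ → IsEigenvalue R A ν
    eigenvalue-cong μ≈ν (v , v≢0 , Av≈μv) = v , v≢0 , λ i → ≈-trans (Av≈μv i) (*-congʳ μ≈ν)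

    spectrum-symmetric : ∀ μ → (IsEigenvalue R A μ → IsEigenvalue R A (- μ))
                             × (IsEigenvalue R A (- μ) → IsEigenvalue R A μ)
    spectrum-symmetric μ =
      eigenvalue-neg μ ,
      λ -μ∈σ → eigenvalue-cong (-‿involutive μ) (eigenvalue-neg (- μ) -μ∈σ)

  checkerboard-anticommutesᴿ : ∀ {n} (A : Matrix ℤ n) → IsCheckerboard A →
    ∀ i j → ℤ→R R (A i j) * signᴿ (suc (toℕ j)) ≈ - (signᴿ (suc (toℕ i)) * ℤ→R R (A i j))
  checkerboard-anticommutesᴿ A checker i j =
    anticommute-entry (suc (toℕ i)) (suc (toℕ j)) _
      (λ even → reflexive (cong (ℤ→R R) (checker i j even)))

mainTheorem1 : ∀ {c ℓ} (n : ℕ) (a b : ℕ) → n ≥ 1 → 2 ∣ (a + b) → a + b > 0 →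
    (A : Matrix ℤ n) → IsPrimeMatrix n ((+ a) +i (+ b)) A →
    (∀ (k l : Fin n) → ((Pmat n *ᴹ A) +ᴹ (A *ᴹ Pmat n)) k l ≡ + 0)
    × (∀ (R : CommutativeRing c ℓ) (μ : CommutativeRing.Carrier R) →
        (IsEigenvalue R A μ → IsEigenvalue R A (CommutativeRing.-_ R μ))
        × (IsEigenvalue R A (CommutativeRing.-_ R μ) → IsEigenvalue R A μ))
mainTheorem1 n a b _ 2∣a+b a+b>0 A isPrime =
  checkerboard-anticommutes A checker ,
  λ R → Spectrum.spectrum-symmetric R A (Spectrum.checkerboard-anticommutesᴿ R A checker)
  where
  checker : IsCheckerboard A
  checker = primeMatrix⇒checkerboard n a b 2∣a+b a+b>0 A isPrime
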